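{- Let $\mathcal{P}$ be a finite poset with two incomparable elements $a,b$ that are smaller than every element of $\mathcal{P}\setminus\{a,b\}$, let $n\in\mathbb{N}$, and let $\mathcal{F}\subseteq 2^{[n]}$ be induced $\mathcal{P}$-saturated. For each $x\in[n]$ with $\{x\}\notin\mathcal{F}$ fix a partner $C_x$ of $x$ of maximum cardinality, and define $f:[n]\to\mathcal{F}\setminus\{\emptyset\}$ by $f(x)=\{x\}$ if $\{x\}\in\mathcal{F}$ and $f(x)=C_x\cup\{x\}$ if $\{x\}\notin\mathcal{F}$. Then $f$ is injective.
   Context: $[n]=\{1,\dots,n\}$. A poset $\mathcal{Q}$ contains an induced copy of $\mathcal{P}$ if there is an injective $g:\mathcal{P}\to\mathcal{Q}$ with $g(u)\preceq g(v)$ iff $u\preceq v$. A family $\mathcal{F}\subseteq 2^{[n]}$ is induced $\mathcal{P}$-saturated if $(\mathcal{F},\subseteq)$ contains no induced copy of $\mathcal{P}$ but for every $F\in 2^{[n]}\setminus\mathcal{F}$, $(\mathcal{F}\cup\{F\},\subseteq)$ contains an induced copy of $\mathcal{P}$. For $x\in[n]$ with $\{x\}\notin\mathcal{F}$, a set $C\in\mathcal{F}$ is a partner of $x$ if there is an injective map $g:\mathcal{P}\to\mathcal{F}\cup\{\{x\}\}$ with $g(u)\subseteq g(v)$ iff $u\preceq v$ and $\{g(a),g(b)\}=\{\{x\},C\}$. (Partners exist for every such $x$, and for every such $x$ one has $C_x\cup\{x\}\in\mathcal{F}\setminus\{\emptyset\}$, so $f$ is well defined.) -}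

module Defs where

open import Data.Nat using (ℕ; _≤_)
open import Data.Bool using (Bool; true; false; if_then_else_)
open import Data.Fin using (Fin)
open import Data.Fin.Subset using (Subset; _⊆_; ⁅_⁆; _∪_; ∣_∣)
open import Data.Product using (Σ; _×_; _,_)
open import Data.Sum using (_⊎_)
open import Relation.Nullary using (¬_)
open import Relation.Binary.PropositionalEquality using (_≡_; _≢_)
open import Relation.Binary.Structures using (IsPartialOrder)
open import Function.Definitions using (Injective)
open import Function.Bundles using (_⇔_)

record FinPoset : Set₁ where
  field
    size   : ℕ
    _≼_    : Fin size → Fin size → Set
    isPO   : IsPartialOrder _≡_ _≼_
  Elt : Set
  Elt = Fin size

open FinPoset public

Family : ℕ → Set
Family n = Subset n → Bool

_∈F_ : ∀ {n} → Subset n → Family n → Set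
S ∈F F = F S ≡ true

_∪F⁅_⁆ : ∀ {n} → Family n → Subset n → Subset n → Set
(F ∪F⁅ S ⁆) T = (T ∈F F) ⊎ (T ≡ S)

IsInducedCopy : ∀ {n} (P : FinPoset) → (Subset n → Set) → (Elt P → Subset n) → Set
IsInducedCopy P G g =
  (∀ u → G (g u)) ×
  Injective _≡_ _≡_ g ×
  (∀ u v → (g u ⊆ g v) ⇔ (_≼_ P u v))

ContainsInduced : ∀ {n} (P : FinPoset) → (Subset n → Set) → Set
ContainsInduced {n} P G = Σ (Elt P → Subset n) (IsInducedCopy P G)

InducedSaturated : ∀ {n} (P : FinPoset) → Family n → Set
InducedSaturated P F =
  ¬ ContainsInduced P (λ T → T ∈F F) ×
  (∀ S → F S ≡ false → ContainsInduced P (F ∪F⁅ S ⁆))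

IsPartner : ∀ {n} (P : FinPoset) (a b : Elt P) (F : Family n) (x : Fin n) (C : Subset n) → Set
IsPartner P a b F x C =
  F ⁅ x ⁆ ≡ false ×
  C ∈F F ×
  Σ _ λ g → IsInducedCopy P (F ∪F⁅ ⁅ x ⁆ ⁆) g ×
    ((g a ≡ ⁅ x ⁆ × g b ≡ C) ⊎ (g a ≡ C × g b ≡ ⁅ x ⁆))

fMap : ∀ {n} (F : Family n) (C : Fin n → Subset n) → Fin n → Subset n
fMap F C x = if F ⁅ x ⁆ then ⁅ x ⁆ else (C x ∪ ⁅ x ⁆)

-- If f x = f y with x ≠ y, then {x} and {y} are both outside F and
-- C_x ∪ {x} = C_y ∪ {y}, so y ∈ C_x, x ∈ C_y and C_y ⊆ C_x ∪ {x}.  Take the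
-- copy of P witnessing that C_x is a partner of x, with {x} at a and C_x at b.
-- Every element other than a lies above b, so its image contains C_x ∋ y, and
-- it contains x exactly when it lies above a.  Replacing {x} by C_y therefore
-- keeps all inclusions: C_y ⊆ C_x ∪ {x} makes it sit below what {x} sat below,
-- and y ∉ C_y keeps it below nothing else.  The result is an induced copy of P
-- inside F, which saturation forbids.
module Submission where

open import Defs
open import Data.Nat using (ℕ; _≤_)
open import Data.Bool using (true; false)
open import Data.Fin using (Fin; _≟_)
open import Data.Fin.Subset using (Subset; ∣_∣; ⁅_⁆; _∈_; _∉_; _⊆_; _∪_)
open import Data.Fin.Subset.Properties using (⊆-trans; x∈⁅x⁆; x∈⁅y⁆⇒x≡y; p⊆p∪q; x∈p∪q⁻; x∈p∪q⁺)
open import Data.Product using (_×_; _,_; proj₁; proj₂)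
open import Data.Sum using (_⊎_; inj₁; inj₂)
open import Data.Empty using (⊥-elim)
open import Relation.Nullary using (¬_; yes; no; contradiction)
open import Relation.Binary.PropositionalEquality using (_≡_; _≢_; refl; sym; trans; subst)
open import Relation.Binary.Structures using (IsPartialOrder)
open import Function.Base using (_∘_)
open import Function.Definitions using (Injective)
open import Function.Bundles using (_⇔_; mk⇔; Equivalence)

b≡true⊎b≡false : ∀ b → b ≡ true ⊎ b ≡ false
b≡true⊎b≡false true = inj₁ refl
b≡true⊎b≡false false = inj₂ refl

module _ {n : ℕ} where

  ∈⇒⁅⁆⊆ : {x : Fin n} {S : Subset n} → x ∈ S → ⁅ x ⁆ ⊆ S
  ∈⇒⁅⁆⊆ {x} x∈S z∈⁅x⁆ = subst (_∈ _) (sym (x∈⁅y⁆⇒x≡y x z∈⁅x⁆)) x∈S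

  ∪-least : {A B S : Subset n} → A ⊆ S → B ⊆ S → A ∪ B ⊆ S
  ∪-least {A} {B} A⊆S B⊆S z∈A∪B with x∈p∪q⁻ A B z∈A∪B
  ... | inj₁ z∈A = A⊆S z∈A
  ... | inj₂ z∈B = B⊆S z∈B

  x∈p∪⁅x⁆ : (A : Subset n) (x : Fin n) → x ∈ A ∪ ⁅ x ⁆
  x∈p∪⁅x⁆ A x = x∈p∪q⁺ (inj₂ (x∈⁅x⁆ x))

  x∈p∪⁅y⁆∧x≢y⇒x∈p : {A : Subset n} {x y : Fin n} → x ∈ A ∪ ⁅ y ⁆ → x ≢ y → x ∈ A
  x∈p∪⁅y⁆∧x≢y⇒x∈p {A} {y = y} x∈A∪⁅y⁆ x≢y with x∈p∪q⁻ A ⁅ y ⁆ x∈A∪⁅y⁆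
  ... | inj₁ x∈A = x∈A
  ... | inj₂ x∈⁅y⁆ = contradiction (x∈⁅y⁆⇒x≡y y x∈⁅y⁆) x≢y

module _ {P : FinPoset} where

  open FinPoset P using () renaming (_≼_ to _⊑_)
  open IsPartialOrder (isPO P) using (antisym) renaming (refl to ⊑-refl)

  record BottomPair (a b : Elt P) : Set where
    field
      a⋢b   : ¬ a ⊑ b
      b⋢a   : ¬ b ⊑ a
      below : ∀ c → c ≢ a → c ≢ b → a ⊑ c × b ⊑ c

    swap : BottomPair b a
    swap = record
      { a⋢b = b⋢a
      ; b⋢a = a⋢b
      ; below = λ c c≢b c≢a → let a⊑c , b⊑c = below c c≢a c≢b in b⊑c , a⊑c
      }

    ⊑-from-b : ∀ v → v ≢ a → b ⊑ v
    ⊑-from-b v v≢a with v ≟ b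
    ... | yes refl = ⊑-refl
    ... | no v≢b = proj₂ (below v v≢a v≢b)

    ⋢-a : ∀ v → v ≢ a → ¬ v ⊑ a
    ⋢-a v v≢a v⊑a with v ≟ b
    ... | yes refl = b⋢a v⊑a
    ... | no v≢b = v≢a (antisym v⊑a (proj₁ (below v v≢a v≢b)))

  module _ {n : ℕ} where

    replace : (Elt P → Subset n) → Elt P → Subset n → Elt P → Subset n
    replace g p D u with u ≟ p
    ... | yes _ = D
    ... | no _ = g u

    replace-isInducedCopy :
      {G G′ : Subset n → Set} {g : Elt P → Subset n} {p : Elt P} {D : Subset n} →
      IsInducedCopy P G g → G′ D → (∀ v → v ≢ p → G′ (g v)) →
      (∀ v → v ≢ p → D ≢ g v) →
      (∀ v → v ≢ p → (D ⊆ g v ⇔ p ⊑ v) × (g v ⊆ D ⇔ v ⊑ p)) →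
      IsInducedCopy P G′ (replace g p D)
    replace-isInducedCopy {G′ = G′} {g} {p} {D} (_ , g-inj , g-rel) D∈G′ g∈G′ D≢g D-rel =
      member , injective , related
      where
      member : ∀ u → G′ (replace g p D u)
      member u with u ≟ p
      ... | yes _ = D∈G′
      ... | no u≢p = g∈G′ u u≢p

      injective : Injective _≡_ _≡_ (replace g p D)
      injective {u} {v} eq with u ≟ p | v ≟ p
      ... | yes u≡p | yes v≡p = trans u≡p (sym v≡p)
      ... | yes _ | no v≢p = contradiction eq (D≢g v v≢p)
      ... | no u≢p | yes _ = contradiction (sym eq) (D≢g u u≢p)
      ... | no _ | no _ = g-inj eq

      related : ∀ u v → (replace g p D u ⊆ replace g p D v) ⇔ (u ⊑ v)
      related u v with u ≟ p | v ≟ p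
      ... | yes refl | yes refl = mk⇔ (λ _ → ⊑-refl) (λ _ {_} z∈D → z∈D)
      ... | yes refl | no v≢p = proj₁ (D-rel v v≢p)
      ... | no u≢p | yes refl = proj₂ (D-rel u u≢p)
      ... | no _ | no _ = g-rel u v

    ∉-image-if-⋢ : {G : Subset n → Set} {g : Elt P → Subset n} {u v : Elt P} {x : Fin n} →
      IsInducedCopy P G g → g u ≡ ⁅ x ⁆ → ¬ u ⊑ v → x ∉ g v
    ∉-image-if-⋢ {g = g} {v = v} (_ , _ , g-rel) gu≡⁅x⁆ u⋢v x∈gv =
      u⋢v (Equivalence.to (g-rel _ v) (subst (_⊆ g v) (sym gu≡⁅x⁆) (∈⇒⁅⁆⊆ x∈gv)))

    ∈F-if-≢ : {F : Family n} {S : Subset n} {g : Elt P → Subset n} {p v : Elt P} →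
      IsInducedCopy P (F ∪F⁅ S ⁆) g → g p ≡ S → v ≢ p → g v ∈F F
    ∈F-if-≢ (g∈ , g-inj , _) gp≡S v≢p with g∈ _
    ... | inj₁ gv∈F = gv∈F
    ... | inj₂ gv≡S = contradiction (g-inj (trans gv≡S (sym gp≡S))) v≢p

    bottom-exchange :
      {a b : Elt P} {F : Family n} {x y : Fin n} {C D : Subset n} {g : Elt P → Subset n} →
      BottomPair a b → IsInducedCopy P (F ∪F⁅ ⁅ x ⁆ ⁆) g → g a ≡ ⁅ x ⁆ → g b ≡ C →
      D ∈F F → x ∈ D → D ⊆ C ∪ ⁅ x ⁆ → y ∈ C → y ∉ D →
      ContainsInduced P (_∈F F)
    bottom-exchange {a} {b} {F} {x} {y} {C} {D} {g} bp copy@(_ , _ , g-rel) ga≡⁅x⁆ gb≡C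
                    D∈F x∈D D⊆C∪⁅x⁆ y∈C y∉D =
      replace g a D , replace-isInducedCopy {G = F ∪F⁅ ⁅ x ⁆ ⁆} {G′ = _∈F F} copy D∈F
        (λ v v≢a → ∈F-if-≢ {F = F} copy ga≡⁅x⁆ v≢a) D≢g D-rel
      where
      open BottomPair bp

      C⊆g : ∀ v → v ≢ a → C ⊆ g v
      C⊆g v v≢a = subst (_⊆ g v) gb≡C (Equivalence.from (g-rel b v) (⊑-from-b v v≢a))

      x∈g⇔a⊑ : ∀ v → x ∈ g v ⇔ a ⊑ v
      x∈g⇔a⊑ v = mk⇔
        (λ x∈gv → Equivalence.to (g-rel a v) (subst (_⊆ g v) (sym ga≡⁅x⁆) (∈⇒⁅⁆⊆ x∈gv)))
        (λ a⊑v → Equivalence.from (g-rel a v) a⊑v (subst (x ∈_) (sym ga≡⁅x⁆) (x∈⁅x⁆ x)))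

      D≢g : ∀ v → v ≢ a → D ≢ g v
      D≢g v v≢a D≡gv = y∉D (subst (y ∈_) (sym D≡gv) (C⊆g v v≢a y∈C))

      D-rel : ∀ v → v ≢ a → (D ⊆ g v ⇔ a ⊑ v) × (g v ⊆ D ⇔ v ⊑ a)
      D-rel v v≢a =
        mk⇔ (λ (D⊆gv : D ⊆ g v) → Equivalence.to (x∈g⇔a⊑ v) (D⊆gv x∈D))
            (λ a⊑v → ⊆-trans D⊆C∪⁅x⁆
              (∪-least (C⊆g v v≢a) (∈⇒⁅⁆⊆ (Equivalence.from (x∈g⇔a⊑ v) a⊑v)))) ,
        mk⇔ (λ (gv⊆D : g v ⊆ D) → contradiction (gv⊆D (C⊆g v v≢a y∈C)) y∉D)
            (λ v⊑a → contradiction v⊑a (⋢-a v v≢a))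

    module _ {a b : Elt P} (bp : BottomPair a b) (F : Family n) where

      partner-∉ : {x : Fin n} {C : Subset n} → IsPartner P a b F x C → x ∉ C
      partner-∉ {x} (_ , _ , _ , copy , inj₁ (ga≡⁅x⁆ , gb≡C)) x∈C =
        ∉-image-if-⋢ {G = F ∪F⁅ ⁅ x ⁆ ⁆} copy ga≡⁅x⁆ (BottomPair.a⋢b bp)
          (subst (x ∈_) (sym gb≡C) x∈C)
      partner-∉ {x} (_ , _ , _ , copy , inj₂ (ga≡C , gb≡⁅x⁆)) x∈C =
        ∉-image-if-⋢ {G = F ∪F⁅ ⁅ x ⁆ ⁆} copy gb≡⁅x⁆ (BottomPair.b⋢a bp)
          (subst (x ∈_) (sym ga≡C) x∈C)

      partner-exchange : {x y : Fin n} {C D : Subset n} → IsPartner P a b F x C →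
        D ∈F F → x ∈ D → D ⊆ C ∪ ⁅ x ⁆ → y ∈ C → y ∉ D →
        ContainsInduced P (_∈F F)
      partner-exchange (_ , _ , _ , copy , inj₁ (ga≡⁅x⁆ , gb≡C)) =
        bottom-exchange {F = F} bp copy ga≡⁅x⁆ gb≡C
      partner-exchange (_ , _ , _ , copy , inj₂ (ga≡C , gb≡⁅x⁆)) =
        bottom-exchange {F = F} (BottomPair.swap bp) copy gb≡⁅x⁆ ga≡C

      equal-images⇒induced-copy : {x y : Fin n} {C D : Subset n} →
        IsPartner P a b F x C → IsPartner P a b F y D →
        x ≢ y → C ∪ ⁅ x ⁆ ≡ D ∪ ⁅ y ⁆ → ContainsInduced P (_∈F F)
      equal-images⇒induced-copy {x} {y} {C} {D} C-partner D-partner@(_ , D∈F , _) x≢y eq =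
        partner-exchange C-partner D∈F x∈D D⊆C∪⁅x⁆ y∈C (partner-∉ D-partner)
        where
        x∈D : x ∈ D
        x∈D = x∈p∪⁅y⁆∧x≢y⇒x∈p (subst (x ∈_) eq (x∈p∪⁅x⁆ C x)) x≢y

        y∈C : y ∈ C
        y∈C = x∈p∪⁅y⁆∧x≢y⇒x∈p (subst (y ∈_) (sym eq) (x∈p∪⁅x⁆ D y)) (x≢y ∘ sym)

        D⊆C∪⁅x⁆ : D ⊆ C ∪ ⁅ x ⁆
        D⊆C∪⁅x⁆ z∈D = subst (_ ∈_) (sym eq) (p⊆p∪q ⁅ y ⁆ z∈D)

module _ {n : ℕ} (F : Family n) (C : Fin n → Subset n) where

  fMap-singleton : ∀ {x} → F ⁅ x ⁆ ≡ true → fMap F C x ≡ ⁅ x ⁆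
  fMap-singleton F⁅x⁆ rewrite F⁅x⁆ = refl

  fMap-outside : ∀ {x} → F ⁅ x ⁆ ≡ false → fMap F C x ≡ C x ∪ ⁅ x ⁆
  fMap-outside F⁅x⁆ rewrite F⁅x⁆ = refl

  ∈-fMap : ∀ x → x ∈ fMap F C x
  ∈-fMap x with F ⁅ x ⁆
  ... | true = x∈⁅x⁆ x
  ... | false = x∈p∪⁅x⁆ (C x) x

  fMap-≡-singleton : ∀ {x y} → F ⁅ x ⁆ ≡ true → fMap F C x ≡ fMap F C y → y ≡ x
  fMap-≡-singleton {x} {y} F⁅x⁆ fx≡fy =
    x∈⁅y⁆⇒x≡y x (subst (y ∈_) (trans (sym fx≡fy) (fMap-singleton F⁅x⁆)) (∈-fMap y))

lemma9 : (P : FinPoset) (a b : Elt P) →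
    a ≢ b → ¬ (_≼_ P a b) → ¬ (_≼_ P b a) →
    (∀ c → c ≢ a → c ≢ b → (_≼_ P a c × _≼_ P b c)) →
    (n : ℕ) (F : Family n) → InducedSaturated P F →
    (C : Fin n → Subset n) →
    (∀ x → F ⁅ x ⁆ ≡ false →
      IsPartner P a b F x (C x) ×
      (∀ D → IsPartner P a b F x D → ∣ D ∣ ≤ ∣ C x ∣)) →
    Injective _≡_ _≡_ (fMap F C)
lemma9 P a b _ a⋢b b⋢a below n F (F-free , _) C C-partner {x} {y} fx≡fy
  with x ≟ y | b≡true⊎b≡false (F ⁅ x ⁆) | b≡true⊎b≡false (F ⁅ y ⁆)
... | yes x≡y | _ | _ = x≡y
... | no _ | inj₁ F⁅x⁆ | _ = sym (fMap-≡-singleton F C F⁅x⁆ fx≡fy)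
... | no _ | _ | inj₁ F⁅y⁆ = fMap-≡-singleton F C F⁅y⁆ (sym fx≡fy)
... | no x≢y | inj₂ F⁅x⁆ | inj₂ F⁅y⁆ = ⊥-elim (F-free
  (equal-images⇒induced-copy bp F (proj₁ (C-partner x F⁅x⁆)) (proj₁ (C-partner y F⁅y⁆)) x≢y
    (trans (sym (fMap-outside F C F⁅x⁆)) (trans fx≡fy (fMap-outside F C F⁅y⁆)))))
  where
  bp : BottomPair {P} a b
  bp = record { a⋢b = a⋢b ; b⋢a = b⋢a ; below = below }
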